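{- Let $b\ge 2$ and $n$ be natural numbers, let $k\ge 0$, and let $d_0,d_1,\ldots,d_k$ be integers with $0\le d_j<b$ for all $j$. Suppose $(d_k,d_{k-1},\ldots,d_0)_b$ is an $(n,b,\sigma)$-permutiple for some permutation $\sigma$ of $\{0,1,\ldots,k\}$. Let $\pi$ and $\tau$ be permutations of $\{0,1,\ldots,k\}$. If $(d_{\pi(k)},d_{\pi(k-1)},\ldots,d_{\pi(0)})_b$ is an $(n,b,\tau)$-permutiple, then \[ \lambda\!\left(d_j+(b-n)\,d_{\pi\tau\pi^{ -1}(j)}\right)\le n-1 \] for all $0\le j\le k$, where $\lambda(x)$ denotes the least non-negative residue of the integer $x$ modulo $b$.
   Context: For a base $b\ge 2$ and integers $0\le d_j<b$, $(d_k,d_{k-1},\ldots,d_0)_b$ denotes the natural number $\sum_{j=0}^k d_j b^j$. Given a natural number $n$ and a permutation $\sigma$ of $\{0,1,\ldots,k\}$, the number $(d_k,\ldots,d_0)_b$ is called an $(n,b,\sigma)$-permutiple if $(d_k,d_{k-1},\ldots,d_1,d_0)_b = n\cdot(d_{\sigma(k)},d_{\sigma(k-1)},\ldots,d_{\sigma(1)},d_{\sigma(0)})_b$. Permutations are composed as functions, so $\pi\tau\pi^{ -1}(j)=\pi(\tau(\pi^{ -1}(j)))$. -}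

module Defs where

open import Data.Nat using (ℕ; zero; suc; _+_; _*_; _<_; NonZero)
open import Data.Fin using (Fin; zero; suc)
open import Data.Fin.Permutation using (Permutation′; _⟨$⟩ʳ_; _⟨$⟩ˡ_)
open import Data.Integer as ℤ using (ℤ; +_)
open import Data.Integer.DivMod using (_%ℕ_)
open import Relation.Binary.PropositionalEquality using (_≡_)

-- (d_k, ..., d_0)_b = Σ_{j=0}^{k} d_j b^j, digits given as d : Fin m → ℕ
-- with d j the digit at position j (coefficient of b^j).
digitVal : (b : ℕ) → ∀ {m} → (Fin m → ℕ) → ℕ
digitVal b {zero}  d = 0
digitVal b {suc m} d = d zero + b * digitVal b (λ j → d (suc j))

IsDigits : (b : ℕ) → ∀ {m} → (Fin m → ℕ) → Set
IsDigits b d = ∀ j → d j < b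

IsPermutiple : (n b : ℕ) → ∀ {m} → Permutation′ m → (Fin m → ℕ) → Set
IsPermutiple n b σ d = digitVal b d ≡ n * digitVal b (λ j → d (σ ⟨$⟩ʳ j))

lam : (b : ℕ) .{{_ : NonZero b}} → ℤ → ℕ
lam b x = x %ℕ b

-- Multiplying y by n digit by digit, column i satisfies x_i + c_{i+1} b = n y_i + c_i,
-- and every carry c_i is below n because y_i < b and the first carry is 0.
-- Hence x_i + (b − n) y_i = c_i + (y_i − c_{i+1}) b, whose residue modulo b is c_i ≤ n − 1.
-- For the digits x = d ∘ π of the second permutiple and y = x ∘ τ, the column at
-- position π⁻¹ j is d_j over d_{πτπ⁻¹ j}.
module Submission where

open import Defs
open import Data.Nat using (ℕ; suc; _≤_; _∸_; NonZero)
open import Data.Fin using (Fin)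
open import Data.Fin.Permutation using (Permutation′; _⟨$⟩ʳ_; _⟨$⟩ˡ_)
open import Data.Integer as ℤ using (ℤ; +_)
open import Data.Product using (Σ)

open import Data.Nat using (zero; _+_; _*_; _<_; _≤?_)
open import Data.Nat.Properties
open import Data.Nat.DivMod
open import Data.Nat.Divisibility using (divides-refl)
open import Data.Nat.Solver using (module +-*-Solver)
import Data.Integer.Solver
module ℤSolver = Data.Integer.Solver.+-*-Solver
open import Data.Integer.DivMod using (n%ℕd<d)
import Data.Integer.Properties as ℤ
open import Data.Fin using (zero; suc)
open import Data.Fin.Permutation using (inverseʳ)
open import Data.Product using (∃₂; _×_; _,_; proj₁; proj₂)
open import Data.Vec.Functional using (tail)
open import Function using (_∘_)
open import Relation.Nullary using (yes; no)
open import Relation.Binary.PropositionalEquality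

module _ {b : ℕ} .{{_ : NonZero b}} where

  %-digit : ∀ {r} q → r < b → (r + q * b) % b ≡ r
  %-digit {r} q r<b = trans ([m+kn]%n≡m%n r q b) (m<n⇒m%n≡m r<b)

  /-digit : ∀ {r} q → r < b → (r + q * b) / b ≡ q
  /-digit {r} q r<b = begin
    (r + q * b) / b    ≡⟨ +-distrib-/-∣ʳ r (divides-refl q) ⟩
    r / b + q * b / b  ≡⟨ cong₂ _+_ (m<n⇒m/n≡0 r<b) (m*n/n≡m q b) ⟩
    q                  ∎
    where open ≡-Reasoning

  divMod-unique : ∀ {r r′ q q′} → r < b → r′ < b → r + q * b ≡ r′ + q′ * b → r ≡ r′ × q ≡ q′
  divMod-unique {q = q} {q′} r<b r′<b eq =
    trans (sym (%-digit q r<b)) (trans (cong (_% b) eq) (%-digit q′ r′<b)) ,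
    trans (sym (/-digit q r<b)) (trans (cong (_/ b) eq) (/-digit q′ r′<b))

  divide-carry : ∀ {x X} s Z → x < b → x + X * b ≡ s + Z * b → x + s / b * b ≡ s × X ≡ Z + s / b
  divide-carry {x} {X} s Z x<b eq with divMod-unique x<b (m%n<n s b) euclid
    where
    open ≡-Reasoning
    euclid : x + X * b ≡ s % b + (s / b + Z) * b
    euclid = begin
      x + X * b                   ≡⟨ eq ⟩
      s + Z * b                   ≡⟨ cong (_+ Z * b) (m≡m%n+[m/n]*n s b) ⟩
      s % b + s / b * b + Z * b   ≡⟨ +-assoc (s % b) (s / b * b) (Z * b) ⟩
      s % b + (s / b * b + Z * b) ≡⟨ cong (λ t → s % b + t) (*-distribʳ-+ b (s / b) Z) ⟨
      s % b + (s / b + Z) * b     ∎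
  ... | x≡s%b , X≡s/b+Z =
    trans (cong (_+ s / b * b) x≡s%b) (sym (m≡m%n+[m/n]*n s b)) , trans X≡s/b+Z (+-comm (s / b) Z)

-- u over v is a column of the long multiplication x = n · y, with incoming carry cᵢ and outgoing carry cᵢ₊₁.
ProductColumn : (b n u v : ℕ) → Set
ProductColumn b n u v = ∃₂ λ cᵢ cᵢ₊₁ → cᵢ < n × u + cᵢ₊₁ * b ≡ n * v + cᵢ

module _ {b n : ℕ} .{{_ : NonZero b}} where

  carry : ℕ → ℕ → ℕ
  carry v c = (n * v + c) / b

  carry-< : ∀ {v c} → v < b → c < n → carry v c < n
  carry-< {v} {c} v<b c<n = m<n*o⇒m/o<n (begin-strict
    n * v + c    <⟨ +-monoʳ-< (n * v) c<n ⟩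
    n * v + n    ≡⟨ trans (+-comm (n * v) n) (sym (*-suc n v)) ⟩
    n * suc v    ≤⟨ *-monoʳ-≤ n v<b ⟩
    n * b        ∎)
    where open ≤-Reasoning

  carry-split : ∀ {m} (x y : Fin (suc m) → ℕ) c → x zero < b →
    digitVal b x ≡ n * digitVal b y + c →
    x zero + carry (y zero) c * b ≡ n * y zero + c ×
    digitVal b (tail x) ≡ n * digitVal b (tail y) + carry (y zero) c
  carry-split x y c x₀<b eq = divide-carry (n * y zero + c) (n * Y) x₀<b shift
    where
    open ≡-Reasoning
    open +-*-Solver
    Y = digitVal b (tail y)
    shift : x zero + digitVal b (tail x) * b ≡ n * y zero + c + n * Y * b
    shift = begin
      x zero + digitVal b (tail x) * b  ≡⟨ cong (λ t → x zero + t) (*-comm (digitVal b (tail x)) b) ⟩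
      digitVal b x                      ≡⟨ eq ⟩
      n * (y zero + b * Y) + c          ≡⟨ solve 5 (λ n y b Y c → n :* (y :+ b :* Y) :+ c
                                                         := (n :* y :+ c) :+ n :* Y :* b)
                                                   refl n (y zero) b Y c ⟩
      n * y zero + c + n * Y * b        ∎

  product-columns : ∀ {m} (x y : Fin m → ℕ) c → IsDigits b x → IsDigits b y → c < n →
    digitVal b x ≡ n * digitVal b y + c → ∀ i → ProductColumn b n (x i) (y i)
  product-columns x y c x<b y<b c<n eq zero =
    c , carry (y zero) c , c<n , proj₁ (carry-split x y c (x<b zero) eq)
  product-columns x y c x<b y<b c<n eq (suc i) =
    product-columns (tail x) (tail y) (carry (y zero) c) (x<b ∘ suc) (y<b ∘ suc)
      (carry-< (y<b zero) c<n)
      (proj₂ (carry-split x y c (x<b zero) eq)) i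

lam-column-≤ : ∀ {b n u v} .{{_ : NonZero b}} → ProductColumn b n u v →
  lam b ((+ u) ℤ.+ ((+ b) ℤ.- (+ n)) ℤ.* (+ v)) ≤ n ∸ 1
lam-column-≤ {b} {n} {u} {v} (c , c′ , c<n , eq) with n ≤? b
... | no n≰b = -- then b ≤ n − 1, and every residue is below b
  ≤-trans (<⇒≤ (n%ℕd<d ((+ u) ℤ.+ ((+ b) ℤ.- (+ n)) ℤ.* (+ v)) b)) (∸-monoˡ-≤ 1 (≰⇒> n≰b))
... | yes n≤b with k , refl ← m≤n⇒∃[o]m+o≡n n≤b =
  ≤-trans (≤-reflexive residue) (≤-trans (m%n≤m c (n + k)) (∸-monoˡ-≤ 1 c<n))
  where
  open ≡-Reasoning
  as-ℕ : (+ u) ℤ.+ ((+ (n + k)) ℤ.- (+ n)) ℤ.* (+ v) ≡ + (u + k * v)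
  as-ℕ = begin
    (+ u) ℤ.+ ((+ (n + k)) ℤ.- (+ n)) ℤ.* (+ v)    ≡⟨ cong (λ t → (+ u) ℤ.+ (t ℤ.- (+ n)) ℤ.* (+ v)) (ℤ.pos-+ n k) ⟩
    (+ u) ℤ.+ ((+ n) ℤ.+ (+ k) ℤ.- (+ n)) ℤ.* (+ v) ≡⟨ ℤSolver.solve 4 (λ u n k v → u :+ (n :+ k :- n) :* v := u :+ k :* v)
                                                          refl (+ u) (+ n) (+ k) (+ v) ⟩
    (+ u) ℤ.+ (+ k) ℤ.* (+ v)                        ≡⟨ cong (λ t → (+ u) ℤ.+ t) (ℤ.pos-* k v) ⟨
    (+ u) ℤ.+ (+ (k * v))                            ≡⟨ ℤ.pos-+ u (k * v) ⟨
    + (u + k * v)                                    ∎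
    where open ℤSolver
  rearranged : u + k * v + c′ * (n + k) ≡ c + v * (n + k)
  rearranged = begin
    u + k * v + c′ * (n + k)   ≡⟨ solve 3 (λ u w z → u :+ w :+ z := u :+ z :+ w) refl u (k * v) (c′ * (n + k)) ⟩
    u + c′ * (n + k) + k * v   ≡⟨ cong (_+ k * v) eq ⟩
    n * v + c + k * v          ≡⟨ solve 4 (λ n v c k → n :* v :+ c :+ k :* v := c :+ v :* (n :+ k)) refl n v c k ⟩
    c + v * (n + k)            ∎
    where open +-*-Solver
  residue : lam (n + k) ((+ u) ℤ.+ ((+ (n + k)) ℤ.- (+ n)) ℤ.* (+ v)) ≡ c % (n + k)
  residue = begin
    lam (n + k) ((+ u) ℤ.+ ((+ (n + k)) ℤ.- (+ n)) ℤ.* (+ v))  ≡⟨ cong (lam (n + k)) as-ℕ ⟩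
    (u + k * v) % (n + k)                                      ≡⟨ [m+kn]%n≡m%n (u + k * v) c′ (n + k) ⟨
    (u + k * v + c′ * (n + k)) % (n + k)                       ≡⟨ cong (_% (n + k)) rearranged ⟩
    (c + v * (n + k)) % (n + k)                                ≡⟨ [m+kn]%n≡m%n c v (n + k) ⟩
    c % (n + k)                                                ∎

theorem2 : (b n k : ℕ) .{{_ : NonZero b}} → 2 ≤ b → 1 ≤ n →
    (d : Fin (suc k) → ℕ) → IsDigits b d →
    Σ (Permutation′ (suc k)) (λ σ → IsPermutiple n b σ d) →
    (π τ : Permutation′ (suc k)) →
    IsPermutiple n b τ (λ j → d (π ⟨$⟩ʳ j)) →
    (j : Fin (suc k)) →
    lam b ((+ d j) ℤ.+ ((+ b) ℤ.- (+ n)) ℤ.* (+ d (π ⟨$⟩ʳ (τ ⟨$⟩ʳ (π ⟨$⟩ˡ j))))) ≤ n ∸ 1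
theorem2 b n k _ 1≤n d d<b _ π τ permutiple j =
  subst (λ i → lam b ((+ d i) ℤ.+ ((+ b) ℤ.- (+ n)) ℤ.* (+ y (π ⟨$⟩ˡ j))) ≤ n ∸ 1)
    (inverseʳ π) (lam-column-≤ (column (π ⟨$⟩ˡ j)))
  where
  x y : Fin (suc k) → ℕ
  x i = d (π ⟨$⟩ʳ i)
  y i = x (τ ⟨$⟩ʳ i)
  column : ∀ i → ProductColumn b n (x i) (y i)
  column = product-columns x y 0 (d<b ∘ (π ⟨$⟩ʳ_)) (d<b ∘ (π ⟨$⟩ʳ_) ∘ (τ ⟨$⟩ʳ_)) 1≤n
    (trans permutiple (sym (+-identityʳ (n * digitVal b y))))
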